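{- Let $n\ge 2$ and let $M$ be an $n\times 2n$ matrix over $\mathbb{F}_2$, viewed as an $n\times n$ block matrix $\tilde M=(b_{ij})$ whose entries $b_{ij}$ are pairs (the $j$-th block of row $i$ being the entries in columns $2j-1,2j$). Suppose $\tilde M$ is half-boxed, i.e.: (1) every entry of the bottom row is $(11)$; (2) every entry of the last block column is $(10)$ except the entry in the last row, which is $(11)$; (3) the diagonal entries $b_{ii}$, $1\le i\le n-1$, are $(01)$, and $b_{nn}=(11)$; (4) all other entries are identical pairs, i.e. $(00)$ or $(11)$. If the rows of $M$ are pairwise orthogonal with respect to the standard dot product $\sum_k a_kc_k$ over $\mathbb{F}_2$, then $\tilde M$ is boxed, i.e. $b_{ij}+b_{ji}=(11)$ for all $n-1\ge i>j\ge 1$.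
   Context: Addition of pairs is componentwise in $\mathbb{F}_2^2$. -}

module Defs where

open import Data.Bool using (Bool; true; false; _xor_; _∧_)
open import Data.Nat using (ℕ; zero; suc; _*_)
open import Data.Fin using (Fin; zero; suc; combine; fromℕ; inject₁; toℕ; _<_)
open import Data.Product using (_×_; _,_)
open import Data.Sum using (_⊎_)
open import Relation.Binary.PropositionalEquality using (_≡_; _≢_)

-- F₂ is represented by Bool: addition = xor, multiplication = ∧.
F₂ : Set
F₂ = Bool

sumF₂ : ∀ {k} → (Fin k → F₂) → F₂
sumF₂ {zero}  f = false
sumF₂ {suc k} f = f zero xor sumF₂ (λ i → f (suc i))

-- An n × 2n matrix over F₂; columns are indexed by Fin (n * 2),
-- column (combine j b) = 2j + b (0-based), b ∈ {0,1}.
Matrix : ℕ → Set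
Matrix n = Fin n → Fin (n * 2) → F₂

rowDot : ∀ {n} → Matrix n → Fin n → Fin n → F₂
rowDot {n} M i k = sumF₂ (λ c → M i c ∧ M k c)

block : ∀ {n} → Matrix n → Fin n → Fin n → F₂ × F₂
block M i j = M i (combine j zero) , M i (combine j (suc zero))

_⊕_ : F₂ × F₂ → F₂ × F₂ → F₂ × F₂
(a , b) ⊕ (c , d) = (a xor c) , (b xor d)

last : ∀ {m} → Fin (suc m)
last {m} = fromℕ m

-- Half-boxed, for size suc m (so indices 0..m, last = m).
record HalfBoxed {m : ℕ} (M : Matrix (suc m)) : Set where
  field
    bottomRow   : ∀ j → block M last j ≡ (true , true)
    lastColumn  : ∀ i → i ≢ last → block M i last ≡ (true , false)
    diagonal    : ∀ i → i ≢ last → block M i i ≡ (false , true)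
    diagonalNN  : block M last last ≡ (true , true)
    others      : ∀ i j → i ≢ last → j ≢ last → i ≢ j →
                  block M i j ≡ (false , false) ⊎ block M i j ≡ (true , true)

-- Boxed: b_ij + b_ji = (11) for all n-1 ≥ i > j ≥ 1 (1-based), i.e.
-- 0-based j < i < last.
Boxed : ∀ {m : ℕ} → Matrix (suc m) → Set
Boxed {m} M = ∀ i j → j < i → i < last {m} →
              (block M i j ⊕ block M j i) ≡ (true , true)

{-# OPTIONS --safe #-}
-- Split the dot product of two rows i ≠ k (both above the bottom row) into the sum over
-- block columns j of (b_ij , b_kj)-products. Block column n contributes (10)·(10) = 1,
-- block column i contributes (01)·b_ki = second entry of b_ki, block column k contributes
-- b_ik·(01) = second entry of b_ik, and every other block column contributes
-- (xx)·(yy) = 2xy = 0. Orthogonality therefore forces the second entries of b_ik and b_ki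
-- to differ, and since both pairs are identical pairs, b_ik + b_ki = (11).
module Submission where

open import Defs
open import Algebra.Bundles using (Monoid; CommutativeMonoid; CommutativeRing)
open import Data.Bool using (true; false; _xor_; _∧_; not; if_then_else_)
open import Data.Bool.Properties
  using (xor-∧-commutativeRing; xor-identityʳ; ∧-zeroʳ; ∧-identityʳ; not-injective)
open import Data.Fin using (Fin; zero; suc; combine; _↑ˡ_; _↑ʳ_; _≟_)
open import Data.Fin.Properties using (<⇒≢; <-trans)
open import Data.Nat using (ℕ; suc; _≤_; _+_; _*_)
open import Data.Product using (_×_; _,_; proj₂)
open import Data.Sum using (_⊎_; inj₁; inj₂)
open import Data.Vec.Functional using (Vector)
open import Function using (_∘_)
open import Relation.Nullary using (yes; no; does; contradiction)
import Relation.Binary.PropositionalEquality as ≡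
open import Relation.Binary.PropositionalEquality using (_≡_; _≢_)

module MonoidSum {c ℓ} (M : Monoid c ℓ) where
  open Monoid M
  open import Algebra.Properties.Monoid.Sum M using (sum; sum-replicate-zero)
  open import Relation.Binary.Reasoning.Setoid setoid

  sum-++ : ∀ m {n} (f : Vector Carrier (m + n)) →
           sum f ≈ sum (f ∘ (_↑ˡ n)) ∙ sum (f ∘ (m ↑ʳ_))
  sum-++ ℕ.zero    f = sym (identityˡ _)
  sum-++ (suc m) {n} f = begin
    f zero ∙ sum (f ∘ suc)
      ≈⟨ ∙-congˡ (sum-++ m (f ∘ suc)) ⟩
    f zero ∙ (sum (f ∘ suc ∘ (_↑ˡ n)) ∙ sum (f ∘ suc ∘ (m ↑ʳ_)))
      ≈⟨ sym (assoc _ _ _) ⟩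
    (f zero ∙ sum (f ∘ suc ∘ (_↑ˡ n))) ∙ sum (f ∘ suc ∘ (m ↑ʳ_)) ∎

  sum-combine : ∀ m {n} (f : Vector Carrier (m * n)) →
                sum f ≈ sum {m} (λ i → sum {n} (λ j → f (combine i j)))
  sum-combine ℕ.zero    f = refl
  sum-combine (suc m) {n} f = begin
    sum f
      ≈⟨ sum-++ n f ⟩
    sum (f ∘ (_↑ˡ m * n)) ∙ sum (f ∘ (n ↑ʳ_))
      ≈⟨ ∙-congˡ (sum-combine m (f ∘ (n ↑ʳ_))) ⟩
    sum (f ∘ (_↑ˡ m * n)) ∙ sum {m} (λ i → sum {n} (λ j → f (combine (suc i) j))) ∎

  -- Opaque, so that a `with j ≟ p` in a client does not abstract inside δ.
  opaque
    δ : ∀ {n} → Fin n → Carrier → Vector Carrier n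
    δ p x j = if does (j ≟ p) then x else ε

  opaque
    unfolding δ

    δ-diag : ∀ {n} (p : Fin n) x → δ p x p ≡ x
    δ-diag p x with p ≟ p
    ... | yes _  = ≡.refl
    ... | no p≢p = contradiction ≡.refl p≢p

    δ-off : ∀ {n} {p j : Fin n} x → j ≢ p → δ p x j ≡ ε
    δ-off {p = p} {j} x j≢p with j ≟ p
    ... | yes j≡p = contradiction j≡p j≢p
    ... | no _    = ≡.refl

    sum-δ : ∀ {n} (p : Fin n) x → sum (δ p x) ≈ x
    sum-δ {suc n} zero    x = trans (∙-congˡ (sum-replicate-zero n)) (identityʳ x)
    sum-δ {suc n} (suc p) x = trans (identityˡ _) (sum-δ p x)

open ≡ using (refl; sym; trans; cong; cong₂; module ≡-Reasoning)

xor-commutativeMonoid : CommutativeMonoid _ _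
xor-commutativeMonoid = CommutativeRing.+-commutativeMonoid xor-∧-commutativeRing

open import Algebra.Properties.CommutativeMonoid.Sum xor-commutativeMonoid
  using (sum; sum-cong-≗; ∑-distrib-+)
open MonoidSum (CommutativeMonoid.monoid xor-commutativeMonoid)

sumF₂≡sum : ∀ {n} (f : Fin n → F₂) → sumF₂ f ≡ sum f
sumF₂≡sum {ℕ.zero} f = refl
sumF₂≡sum {suc n}  f = cong (f zero xor_) (sumF₂≡sum (f ∘ suc))

blockDot : F₂ × F₂ → F₂ × F₂ → F₂
blockDot (a , b) (c , d) = (a ∧ c) xor (b ∧ d)

rowDot≡∑blockDot : ∀ {n} (M : Matrix n) i k →
                   rowDot M i k ≡ sum (λ j → blockDot (block M i j) (block M k j))
rowDot≡∑blockDot {n} M i k = begin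
  rowDot M i k                                     ≡⟨ sumF₂≡sum (λ c → M i c ∧ M k c) ⟩
  sum (λ c → M i c ∧ M k c)                        ≡⟨ sum-combine n {2} _ ⟩
  sum {n} (λ j → sum {2} (λ b → M i (combine j b) ∧ M k (combine j b)))
    ≡⟨ sum-cong-≗ {n} (λ j → cong (M i (c₀ j) ∧ M k (c₀ j) xor_)
                                  (xor-identityʳ (M i (c₁ j) ∧ M k (c₁ j)))) ⟩
  sum (λ j → blockDot (block M i j) (block M k j)) ∎
  where
  open ≡-Reasoning
  c₀ c₁ : Fin n → Fin (n * 2)
  c₀ j = combine j zero
  c₁ j = combine j (suc zero)

IdenticalPair : F₂ × F₂ → Set
IdenticalPair p = p ≡ (false , false) ⊎ p ≡ (true , true)

blockDot-identical : ∀ {p q} → IdenticalPair p → IdenticalPair q → blockDot p q ≡ false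
blockDot-identical (inj₁ refl) _           = refl
blockDot-identical (inj₂ refl) (inj₁ refl) = refl
blockDot-identical (inj₂ refl) (inj₂ refl) = refl

blockDot-01ʳ : ∀ p → blockDot p (false , true) ≡ proj₂ p
blockDot-01ʳ (a , b) = cong₂ _xor_ (∧-zeroʳ a) (∧-identityʳ b)

⊕-identical : ∀ {p q} → IdenticalPair p → IdenticalPair q →
              proj₂ p xor proj₂ q ≡ true → p ⊕ q ≡ (true , true)
⊕-identical (inj₁ refl) (inj₁ refl) ()
⊕-identical (inj₁ refl) (inj₂ refl) _ = refl
⊕-identical (inj₂ refl) (inj₁ refl) _ = refl
⊕-identical (inj₂ refl) (inj₂ refl) ()

module HalfBoxedRows {m} {M : Matrix (suc m)} (H : HalfBoxed M) {i k : Fin (suc m)}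
                     (i≢last : i ≢ last) (k≢last : k ≢ last) (i≢k : i ≢ k) where
  open HalfBoxed H

  bᵢₖ bₖᵢ : F₂
  bᵢₖ = proj₂ (block M i k)
  bₖᵢ = proj₂ (block M k i)

  private
    δ-row≡ : ∀ j {a b c} → δ last true j ≡ a → δ k bᵢₖ j ≡ b → δ i bₖᵢ j ≡ c →
             δ last true j xor (δ k bᵢₖ j xor δ i bₖᵢ j) ≡ a xor (b xor c)
    δ-row≡ _ eₐ e_b e_c = cong₂ _xor_ eₐ (cong₂ _xor_ e_b e_c)

  blockDot-row : ∀ j → blockDot (block M i j) (block M k j) ≡
                       δ last true j xor (δ k bᵢₖ j xor δ i bₖᵢ j)
  blockDot-row j with j ≟ last
  ... | yes refl = trans
    (cong₂ blockDot (lastColumn i i≢last) (lastColumn k k≢last))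
    (sym (δ-row≡ j (δ-diag last true) (δ-off bᵢₖ (k≢last ∘ sym))
                   (δ-off bₖᵢ (i≢last ∘ sym))))
  ... | no j≢last with j ≟ i
  ...   | yes refl = trans
    (cong (λ p → blockDot p (block M k i)) (diagonal i i≢last))
    (sym (δ-row≡ j (δ-off true j≢last) (δ-off bᵢₖ i≢k) (δ-diag i bₖᵢ)))
  ...   | no j≢i with j ≟ k
  ...     | yes refl = trans
    (trans (cong (blockDot (block M i k)) (diagonal k k≢last)) (blockDot-01ʳ (block M i k)))
    (sym (trans (δ-row≡ j (δ-off true j≢last) (δ-diag k bᵢₖ) (δ-off bₖᵢ (i≢k ∘ sym)))
                (xor-identityʳ bᵢₖ)))
  ...     | no j≢k = trans
    (blockDot-identical (others i j i≢last j≢last (j≢i ∘ sym))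
                        (others k j k≢last j≢last (j≢k ∘ sym)))
    (sym (δ-row≡ j (δ-off true j≢last) (δ-off bᵢₖ j≢k) (δ-off bₖᵢ j≢i)))

  rowDot-offDiagonal : rowDot M i k ≡ not (bᵢₖ xor bₖᵢ)
  rowDot-offDiagonal = begin
    rowDot M i k                                       ≡⟨ rowDot≡∑blockDot M i k ⟩
    sum (λ j → blockDot (block M i j) (block M k j))   ≡⟨ sum-cong-≗ blockDot-row ⟩
    sum (λ j → δ ℓ true j xor (δ k bᵢₖ j xor δ i bₖᵢ j))
      ≡⟨ ∑-distrib-+ (δ ℓ true) (λ j → δ k bᵢₖ j xor δ i bₖᵢ j) ⟩
    sum (δ ℓ true) xor sum (λ j → δ k bᵢₖ j xor δ i bₖᵢ j)
      ≡⟨ cong₂ _xor_ (sum-δ ℓ true) (∑-distrib-+ (δ k bᵢₖ) (δ i bₖᵢ)) ⟩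
    true xor (sum (δ k bᵢₖ) xor sum (δ i bₖᵢ))
      ≡⟨ cong (true xor_) (cong₂ _xor_ (sum-δ k bᵢₖ) (sum-δ i bₖᵢ)) ⟩
    true xor (bᵢₖ xor bₖᵢ)                             ∎
    where
    open ≡-Reasoning
    ℓ : Fin (suc m)
    ℓ = last

mainTheorem4 : (m : ℕ) → 2 ≤ suc m → (M : Matrix (suc m)) →
    HalfBoxed M →
    (∀ (i k : Fin (suc m)) → i ≢ k → rowDot M i k ≡ false) →
    Boxed M
mainTheorem4 m _ M H orthogonal i j j<i i<last =
  ⊕-identical (others i j i≢last j≢last i≢j) (others j i j≢last i≢last (i≢j ∘ sym))
    (not-injective (trans (sym rowDot-offDiagonal) (orthogonal i j i≢j)))
  where
  open HalfBoxed H
  i≢last : i ≢ last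
  i≢last = <⇒≢ i<last
  j≢last : j ≢ last
  j≢last = <⇒≢ (<-trans j<i i<last)
  i≢j : i ≢ j
  i≢j = <⇒≢ j<i ∘ sym
  open HalfBoxedRows H i≢last j≢last i≢j
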